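{- Let $p$ be an odd prime and $n\geq 1$ an integer. Then the polynomials $P(p^n,p^n+1,x)$, $Q(p^n-1,p^n,x)$, $P(p^n,p^n,x)$ and $Q(p^n,p^n,x)$ are irreducible over $\mathbf{Q}$.
   Context: For positive integers $u,v$ define $P(u,v,x)=\sum_{j=0}^{u}\frac{(u+v-j)!}{v!}\binom{u}{j}x^j$ and $Q(u,v,x)=\sum_{j=0}^{v}\frac{(u+v-j)!}{u!}\binom{v}{j}(-x)^j$. -}

module Defs where

open import Data.Nat as ℕ using (ℕ; zero; suc; _∸_; _!; _≤_)
open import Data.Nat.DivMod using (_/_)
open import Data.Nat.Properties using (_!≢0)
open import Data.Nat.Combinatorics using (_C_)
open import Data.List using (List; []; _∷_; map; upTo; foldr)
open import Data.Integer using (+_)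
open import Data.Rational as ℚ using (ℚ; 0ℚ; 1ℚ; _*_; -_)
open import Data.Sum using (_⊎_)
open import Data.Product using (_×_)
open import Relation.Binary.PropositionalEquality using (_≡_)
open import Relation.Nullary using (¬_)

-- Polynomials with rational coefficients, represented by their coefficient
-- lists (constant term first).  Trailing zeros are allowed; all notions below
-- only depend on the coefficient function `coeff`.
Poly : Set
Poly = List ℚ

coeff : Poly → ℕ → ℚ
coeff []       k       = 0ℚ
coeff (a ∷ f)  zero    = a
coeff (a ∷ f)  (suc k) = coeff f k

sumℚ : List ℚ → ℚ
sumℚ = foldr ℚ._+_ 0ℚ

ℕ→ℚ : ℕ → ℚ
ℕ→ℚ m = (+ m) ℚ./ 1

mulCoeff : Poly → Poly → ℕ → ℚ
mulCoeff g h k = sumℚ (map (λ i → coeff g i * coeff h (k ∸ i)) (upTo (suc k)))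

IsProduct : Poly → Poly → Poly → Set
IsProduct g h f = ∀ k → mulCoeff g h k ≡ coeff f k

IsConstant : Poly → Set
IsConstant g = ∀ k → 1 ≤ k → coeff g k ≡ 0ℚ

-- Irreducible over ℚ: f is non-constant and in every factorisation f = g·h
-- in ℚ[x] one factor is constant (i.e. a unit, as f ≠ 0).
Irreducible : Poly → Set
Irreducible f = ¬ IsConstant f × (∀ g h → IsProduct g h f → IsConstant g ⊎ IsConstant h)

-- (u+v-j)!/v! · binom(u,j)  (exact division since u+v-j ≥ v for j ≤ u)
P-coeff : ℕ → ℕ → ℕ → ℕ
P-coeff u v j = (_/_ ((u ℕ.+ v ∸ j) !) (v !) {{v !≢0}}) ℕ.* (u C j)

-- (u+v-j)!/u! · binom(v,j)  (exact division since u+v-j ≥ u for j ≤ v)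
Q-coeff : ℕ → ℕ → ℕ → ℕ
Q-coeff u v j = (_/_ ((u ℕ.+ v ∸ j) !) (u !) {{u !≢0}}) ℕ.* (v C j)

signℚ : ℕ → ℚ
signℚ zero    = 1ℚ
signℚ (suc j) = - signℚ j

P : ℕ → ℕ → Poly
P u v = map (λ j → ℕ→ℚ (P-coeff u v j)) (upTo (suc u))

Q : ℕ → ℕ → Poly
Q u v = map (λ j → signℚ j * ℕ→ℚ (Q-coeff u v j)) (upTo (suc v))

-- Dumas' criterion.  Put N = p^n and c = ν_p(N!).  Each of the four polynomials has
-- degree N, leading coefficient ±1, constant coefficient of valuation c, and its j-th
-- coefficient a_j satisfies N! ∣ a_j·j!; with Legendre's bound (p−1)·ν_p(j!) < j this puts
-- every point (j, ν_p(a_j)) on or above the segment from (0, c) to (N, 0), that is,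
-- N·ν_p(a_j) + c·j ≥ N·c.  The weight N·ν_p(x) + c·k of a coefficient x at index k is
-- additive on products, and for f = g·h the minimal weight of f is the sum of the minimal
-- weights of g and h.  The constant and leading coefficients of f lie on the segment, so
-- those of g have the same (minimal) weight; hence N ∣ c·deg g, and since p ∤ c this
-- gives N ∣ deg g, so one of the factors is constant.

module Submission where

open import Defs
open import Data.Nat
  using (ℕ; zero; suc; _+_; _*_; _∸_; _^_; _!; _≤_; _<_; _≥_; z≤n; s≤s; s<s; z<s; s≤s⁻¹;
         NonZero; ≢-nonZero; ≢-nonZero⁻¹; >-nonZero; nonTrivial⇒n>1)
open import Data.Nat.Properties
open import Data.Nat.Combinatorics using (_C_; nCn≡1; nCk≡nC[n∸k]; nCk≡n!/k![n-k]!; k![n∸k]!∣n!)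
open import Data.Nat.Divisibility
  using (_∣_; _∤_; divides; _∣?_; ∣-trans; ∣1⇒≡1; m∣m*n; ∣⇒≤; ∣m+n∣m⇒∣n; ∣m∣n⇒∣m+n; m≤n⇒m!∣n!)
open import Data.Nat.DivMod using (_/_; _%_; m≡m%n+[m/n]*n; m%n<n; m/n*n≡m; n/n≡1)
open import Data.Nat.Induction using (<-rec)
open import Data.Nat.Primality using (Prime; euclidsLemma; prime⇒nonZero; prime⇒nonTrivial)
import Data.Nat.Tactic.RingSolver as ℕ-Solver
open import Data.Integer as ℤ using (ℤ; +_; ∣_∣; +≤+; 0ℤ; _⊖_)
import Data.Integer.Properties as ℤ
import Data.Integer.Divisibility.Signed as ℤ∣
open import Data.Integer.GCD using (gcd)
import Data.Integer.Tactic.RingSolver as ℤ-Solver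
open import Data.Rational as ℚ using (ℚ; ↥_; ↧_; ↧ₙ_; 0ℚ)
import Data.Rational.Properties as ℚ
open import Data.List using ([]; _∷_; map; upTo; applyUpTo)
open import Data.List.Properties using (map-upTo; map-cong)
open import Data.Product using (∃-syntax; _×_; _,_; proj₁; proj₂)
open import Data.Sum as Sum using (_⊎_; inj₁; inj₂; [_,_]′)
open import Function using (_∘_; id)
open import Relation.Binary.Definitions using (tri<; tri≈; tri>)
open import Relation.Binary.PropositionalEquality
open import Relation.Nullary using (¬_; yes; no; contradiction)
import Algebra.Properties.CommutativeSemigroup *-commutativeSemigroup as ℕ*
import Algebra.Properties.CommutativeSemigroup ℤ.*-commutativeSemigroup as ℤ*
import Algebra.Properties.AbelianGroup ℤ.+-0-abelianGroup as ℤ-Group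

i*j≢0 : ∀ {i j} → i ≢ 0ℤ → j ≢ 0ℤ → i ℤ.* j ≢ 0ℤ
i*j≢0 {i} {j} i≢0 j≢0 i*j≡0 with m*n≡0⇒m≡0∨n≡0 ∣ i ∣ (trans (sym (ℤ.∣i*j∣≡∣i∣*∣j∣ i j)) (cong ∣_∣ i*j≡0))
... | inj₁ ∣i∣≡0 = i≢0 (ℤ.∣i∣≡0⇒i≡0 ∣i∣≡0)
... | inj₂ ∣j∣≡0 = j≢0 (ℤ.∣i∣≡0⇒i≡0 ∣j∣≡0)

m-n≡o-q : ∀ {m n o q} → m + q ≡ o + n → + m ℤ.- + n ≡ + o ℤ.- + q
m-n≡o-q {m} {n} {o} {q} m+q≡o+n = begin
  + m ℤ.- + n           ≡⟨ ℤ.m-n≡m⊖n m n ⟩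
  m ⊖ n                 ≡⟨ ℤ.+-cancelˡ-⊖ q m n ⟨
  (q + m) ⊖ (q + n)     ≡⟨ cong₂ _⊖_ (trans (+-comm q m) (trans m+q≡o+n (+-comm o n))) (+-comm q n) ⟩
  (n + o) ⊖ (n + q)     ≡⟨ ℤ.+-cancelˡ-⊖ n o q ⟩
  o ⊖ q                 ≡⟨ ℤ.m-n≡m⊖n o q ⟨
  + o ℤ.- + q           ∎
  where open ≡-Reasoning

i-j+j≡i : ∀ i j → i ℤ.- j ℤ.+ j ≡ i
i-j+j≡i = ℤ-Solver.solve-∀

m-k≤n-k⇒m≤n : ∀ {m n} k → + m ℤ.- + k ℤ.≤ + n ℤ.- + k → m ≤ n
m-k≤n-k⇒m≤n {m} {n} k le = ℤ.drop‿+≤+ (subst₂ ℤ._≤_ (i-j+j≡i (+ m) (+ k)) (i-j+j≡i (+ n) (+ k)) (ℤ.+-monoˡ-≤ (+ k) le))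

m-k<n-k⇒m<n : ∀ {m n} k → + m ℤ.- + k ℤ.< + n ℤ.- + k → m < n
m-k<n-k⇒m<n {m} {n} k lt = ℤ.drop‿+<+ (subst₂ ℤ._<_ (i-j+j≡i (+ m) (+ k)) (i-j+j≡i (+ n) (+ k)) (ℤ.+-monoˡ-< (+ k) lt))

↧≢0 : ∀ x → ↧ x ≢ 0ℤ
↧≢0 x ()

↥≢0 : ∀ {x} → x ≢ 0ℚ → ↥ x ≢ 0ℤ
↥≢0 {x} x≢0 = x≢0 ∘ ℚ.↥p≡0⇒p≡0 x

cross-multiply : ∀ x {g A B} → ↥ x ℤ.* g ≡ A → ↧ x ℤ.* g ≡ B → ↥ x ℤ.* B ≡ A ℤ.* ↧ x
cross-multiply x {g} refl refl = ℤ*.x∙yz≈xz∙y (↥ x) (↧ x) g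

x*y≢0 : ∀ {x y} → x ≢ 0ℚ → y ≢ 0ℚ → x ℚ.* y ≢ 0ℚ
x*y≢0 {x} {y} x≢0 y≢0 xy≡0 =
  i*j≢0 (↥≢0 x≢0) (↥≢0 y≢0) (trans (sym (ℚ.↥-* x y)) (cong (λ z → ↥ z ℤ.* gcd (↥ x ℤ.* ↥ y) (↧ x ℤ.* ↧ y)) xy≡0))

x*y≡0 : ∀ {x y} → x ≡ 0ℚ ⊎ y ≡ 0ℚ → x ℚ.* y ≡ 0ℚ
x*y≡0 {y = y} (inj₁ refl) = ℚ.*-zeroˡ y
x*y≡0 {x = x} (inj₂ refl) = ℚ.*-zeroʳ x

factors≢0 : ∀ {x y} → x ℚ.* y ≢ 0ℚ → x ≢ 0ℚ × y ≢ 0ℚ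
factors≢0 {x} {y} xy≢0 = (λ x≡0 → xy≢0 (x*y≡0 (inj₁ x≡0))) , (λ y≡0 → xy≢0 (x*y≡0 {x} (inj₂ y≡0)))

≤-+-≤⇒≡ˡ : ∀ {i j a b} → i ℤ.≤ a → j ℤ.≤ b → a ℤ.+ b ℤ.≤ i ℤ.+ j → a ≡ i
≤-+-≤⇒≡ˡ {i} {j} {a} i≤a j≤b a+b≤i+j with a ℤ.≤? i
... | yes a≤i = ℤ.≤-antisym a≤i i≤a
... | no  a≰i = contradiction a+b≤i+j (ℤ.<⇒≱ (ℤ.+-mono-<-≤ (ℤ.≰⇒> a≰i) j≤b))

module Valuation (p : ℕ) (p-prime : Prime p) where

  instance
    p-nonZero : NonZero p
    p-nonZero = prime⇒nonZero p-prime

  1<p : 1 < p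
  1<p = nonTrivial⇒n>1 p {{prime⇒nonTrivial p-prime}}

  p∤1 : p ∤ 1
  p∤1 p∣1 = <-irrefl (sym (∣1⇒≡1 p∣1)) 1<p

  p∣p^[1+k]*r : ∀ k r → p ∣ p ^ suc k * r
  p∣p^[1+k]*r k r = subst (p ∣_) (sym (*-assoc p (p ^ k) r)) (m∣m*n (p ^ k * r))

  record Split (m : ℕ) : Set where
    field
      exponent cofactor : ℕ
      m≡p^e*r : m ≡ p ^ exponent * cofactor
      p∤cofactor : p ∤ cofactor

  split-* : ∀ {q} → Split q → Split (q * p)
  split-* {q} s = record
    { exponent = suc exponent ; cofactor = cofactor ; p∤cofactor = p∤cofactor
    ; m≡p^e*r = trans (*-comm q p) (trans (cong (p *_) m≡p^e*r) (sym (*-assoc p (p ^ exponent) cofactor)))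
    }
    where open Split s

  split : ∀ m → m ≢ 0 → Split m
  split = <-rec (λ m → m ≢ 0 → Split m) go
    where
    go : ∀ m → (∀ {k} → k < m → k ≢ 0 → Split k) → m ≢ 0 → Split m
    go m rec m≢0 with p ∣? m
    ... | no p∤m = record { exponent = 0 ; cofactor = m ; m≡p^e*r = sym (*-identityˡ m) ; p∤cofactor = p∤m }
    ... | yes (divides q refl) = split-* (rec (m<m*n q p {{≢-nonZero q≢0}} 1<p) q≢0)
      where
      q≢0 : q ≢ 0
      q≢0 refl = m≢0 refl

  -- ν m is the exponent of p in m, with the junk value ν 0 = 0.
  ν : ℕ → ℕ
  ν zero        = 0
  ν m@(suc _)   = Split.exponent (split m λ ())

  ν-split : ∀ m → m ≢ 0 → ∃[ r ] m ≡ p ^ ν m * r × p ∤ r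
  ν-split zero      0≢0 = contradiction refl 0≢0
  ν-split m@(suc _) _   = cofactor , m≡p^e*r , p∤cofactor
    where open Split (split m λ ())

  exponent-unique : ∀ {k k′ r r′} → p ^ k * r ≡ p ^ k′ * r′ → p ∤ r → p ∤ r′ → k ≡ k′
  exponent-unique {zero}  {zero}            _  _   _    = refl
  exponent-unique {zero}  {suc k′} {r} {r′} eq p∤r _    =
    contradiction (subst (p ∣_) (trans (sym eq) (*-identityˡ r)) (p∣p^[1+k]*r k′ r′)) p∤r
  exponent-unique {suc k} {zero}   {r} {r′} eq _   p∤r′ =
    contradiction (subst (p ∣_) (trans eq (*-identityˡ r′)) (p∣p^[1+k]*r k r)) p∤r′
  exponent-unique {suc k} {suc k′} {r} {r′} eq p∤r p∤r′ = cong suc (exponent-unique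
    (*-cancelˡ-≡ _ _ p (trans (sym (*-assoc p (p ^ k) r)) (trans eq (*-assoc p (p ^ k′) r′)))) p∤r p∤r′)

  p^k*r≢0 : ∀ k {r} → p ∤ r → p ^ k * r ≢ 0
  p^k*r≢0 k {zero}  p∤0 = contradiction (divides 0 refl) p∤0
  p^k*r≢0 k {suc r} _   = ≢-nonZero⁻¹ _ {{m*n≢0 (p ^ k) (suc r) {{m^n≢0 p k}}}}

  ν-unique : ∀ {m k r} → m ≡ p ^ k * r → p ∤ r → ν m ≡ k
  ν-unique {k = k} refl p∤r with ν-split _ (p^k*r≢0 k p∤r)
  ... | _ , eq , p∤r′ = exponent-unique (sym eq) p∤r′ p∤r

  ν-* : ∀ {a b} → a ≢ 0 → b ≢ 0 → ν (a * b) ≡ ν a + ν b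
  ν-* {a} {b} a≢0 b≢0 with ν-split a a≢0 | ν-split b b≢0
  ... | r , a≡ , p∤r | s , b≡ , p∤s = ν-unique a*b≡ p∤r*s
    where
    p∤r*s : p ∤ r * s
    p∤r*s p∣r*s with euclidsLemma r s p-prime p∣r*s
    ... | inj₁ p∣r = p∤r p∣r
    ... | inj₂ p∣s = p∤s p∣s
    a*b≡ : a * b ≡ p ^ (ν a + ν b) * (r * s)
    a*b≡ = begin
      a * b                               ≡⟨ cong₂ _*_ a≡ b≡ ⟩
      (p ^ ν a * r) * (p ^ ν b * s)       ≡⟨ ℕ*.interchange (p ^ ν a) r (p ^ ν b) s ⟩
      (p ^ ν a * p ^ ν b) * (r * s)       ≡⟨ cong (_* (r * s)) (^-distribˡ-+-* p (ν a) (ν b)) ⟨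
      p ^ (ν a + ν b) * (r * s)           ∎
      where open ≡-Reasoning

  ν-^ : ∀ k → ν (p ^ k) ≡ k
  ν-^ k = ν-unique (sym (*-identityʳ (p ^ k))) p∤1

  ν-p : ν p ≡ 1
  ν-p = trans (cong ν (sym (*-identityʳ p))) (ν-^ 1)

  p∤⇒ν≡0 : ∀ {m} → p ∤ m → ν m ≡ 0
  p∤⇒ν≡0 {m} = ν-unique (sym (*-identityˡ m))

  ν-1 : ν 1 ≡ 0
  ν-1 = p∤⇒ν≡0 p∤1

  p^ν∣ : ∀ m → p ^ ν m ∣ m
  p^ν∣ zero        = divides 0 refl
  p^ν∣ m@(suc _) with ν-split m (λ ())
  ... | r , m≡ , _ = divides r (trans m≡ (*-comm (p ^ ν m) r))

  ν-mono-∣ : ∀ {a b} → b ≢ 0 → a ∣ b → ν a ≤ ν b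
  ν-mono-∣ {a} b≢0 (divides k refl) =
    subst (ν a ≤_) (sym (ν-* {k} (λ k≡0 → b≢0 (cong (_* a) k≡0)) (λ a≡0 → b≢0 (trans (cong (k *_) a≡0) (*-zeroʳ k)))))
      (m≤n+m (ν a) (ν k))

  ^∣⇒≤ν : ∀ {j m} → m ≢ 0 → p ^ j ∣ m → j ≤ ν m
  ^∣⇒≤ν {j} m≢0 p^j∣m = subst (_≤ _) (ν-^ j) (ν-mono-∣ m≢0 p^j∣m)

  ≤ν⇒^∣ : ∀ {j m} → j ≤ ν m → p ^ j ∣ m
  ≤ν⇒^∣ {j} {m} j≤ν = ∣-trans (divides (p ^ (ν m ∸ j)) p^ν≡) (p^ν∣ m)
    where
    p^ν≡ : p ^ ν m ≡ p ^ (ν m ∸ j) * p ^ j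
    p^ν≡ = trans (cong (p ^_) (sym (m∸n+n≡m j≤ν))) (^-distribˡ-+-* p (ν m ∸ j) j)

  νℤ : ℤ → ℕ
  νℤ a = ν ∣ a ∣

  ∣i∣≢0 : ∀ {a} → a ≢ 0ℤ → ∣ a ∣ ≢ 0
  ∣i∣≢0 a≢0 = a≢0 ∘ ℤ.∣i∣≡0⇒i≡0

  νℤ-* : ∀ {a b} → a ≢ 0ℤ → b ≢ 0ℤ → νℤ (a ℤ.* b) ≡ νℤ a + νℤ b
  νℤ-* {a} {b} a≢0 b≢0 = trans (cong ν (ℤ.∣i*j∣≡∣i∣*∣j∣ a b)) (ν-* (∣i∣≢0 a≢0) (∣i∣≢0 b≢0))

  ≤νℤ⇒∣ : ∀ {k} a → k ≤ νℤ a → + (p ^ k) ℤ∣.∣ a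
  ≤νℤ⇒∣ _ k≤νa = ℤ∣.∣ᵤ⇒∣ (≤ν⇒^∣ k≤νa)

  ∣⇒≤νℤ : ∀ {k a} → a ≢ 0ℤ → + (p ^ k) ℤ∣.∣ a → k ≤ νℤ a
  ∣⇒≤νℤ a≢0 p^k∣a = ^∣⇒≤ν (∣i∣≢0 a≢0) (ℤ∣.∣⇒∣ᵤ p^k∣a)

  νℤ-+ : ∀ {a b} → νℤ a ≤ νℤ b → a ℤ.+ b ≢ 0ℤ → νℤ a ≤ νℤ (a ℤ.+ b)
  νℤ-+ {a} {b} νa≤νb a+b≢0 = ∣⇒≤νℤ a+b≢0 (ℤ∣.∣m∣n⇒∣m+n (≤νℤ⇒∣ a ≤-refl) (≤νℤ⇒∣ b νa≤νb))

  νℤ-+-< : ∀ {a b} → a ≢ 0ℤ → νℤ a < νℤ b → a ℤ.+ b ≢ 0ℤ × νℤ (a ℤ.+ b) ≡ νℤ a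
  νℤ-+-< {a} {b} a≢0 νa<νb = a+b≢0 , ≤-antisym ν[a+b]≤νa (νℤ-+ {a} {b} (<⇒≤ νa<νb) a+b≢0)
    where
    a+b≢0 : a ℤ.+ b ≢ 0ℤ
    a+b≢0 a+b≡0 = <-irrefl (trans (cong νℤ (ℤ-Group.inverseˡ-unique a b a+b≡0)) (cong ν (ℤ.∣-i∣≡∣i∣ b))) νa<νb
    ν[a+b]≤νa : νℤ (a ℤ.+ b) ≤ νℤ a
    ν[a+b]≤νa = ≮⇒≥ λ νa<ν[a+b] →
      <-irrefl refl (∣⇒≤νℤ a≢0 (ℤ∣.∣m+n∣n⇒∣m (≤νℤ⇒∣ (a ℤ.+ b) νa<ν[a+b]) (≤νℤ⇒∣ b νa<νb)))

  -- ν(a/b) = ν(a) − ν(b) on the normalised fraction; again νℚ 0ℚ = 0 is junk.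
  νℚ : ℚ → ℤ
  νℚ x = + νℤ (↥ x) ℤ.- + ν (↧ₙ x)

  ratio-↥≢0 : ∀ x {A B} → A ≢ 0ℤ → ↥ x ℤ.* B ≡ A ℤ.* ↧ x → ↥ x ≢ 0ℤ
  ratio-↥≢0 x {A} {B} A≢0 eq ↥x≡0 = i*j≢0 A≢0 (↧≢0 x) (trans (sym eq) (cong (ℤ._* B) ↥x≡0))

  νℚ-ratio : ∀ x {A B} → A ≢ 0ℤ → B ≢ 0ℤ → ↥ x ℤ.* B ≡ A ℤ.* ↧ x → νℚ x ≡ + νℤ A ℤ.- + νℤ B
  νℚ-ratio x {A} {B} A≢0 B≢0 eq = m-n≡o-q {νℤ (↥ x)} {ν (↧ₙ x)} (begin
    νℤ (↥ x) + νℤ B     ≡⟨ νℤ-* (ratio-↥≢0 x A≢0 eq) B≢0 ⟨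
    νℤ (↥ x ℤ.* B)      ≡⟨ cong νℤ eq ⟩
    νℤ (A ℤ.* ↧ x)      ≡⟨ νℤ-* A≢0 (↧≢0 x) ⟩
    νℤ A + ν (↧ₙ x)     ∎)
    where open ≡-Reasoning

  νℚ-* : ∀ {x y} → x ≢ 0ℚ → y ≢ 0ℚ → νℚ (x ℚ.* y) ≡ νℚ x ℤ.+ νℚ y
  νℚ-* {x} {y} x≢0 y≢0 = begin
    νℚ (x ℚ.* y)                                         ≡⟨ νℚ-ratio (x ℚ.* y) A≢0 B≢0 cross ⟩
    + νℤ A ℤ.- + νℤ B                                    ≡⟨ cong₂ (λ a b → + a ℤ.- + b) νA≡ νB≡ ⟩
    + (νℤ (↥ x) + νℤ (↥ y)) ℤ.- + (ν (↧ₙ x) + ν (↧ₙ y))  ≡⟨ regroup (νℤ (↥ x)) (νℤ (↥ y)) (ν (↧ₙ x)) (ν (↧ₙ y)) ⟩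
    νℚ x ℤ.+ νℚ y                                        ∎
    where
    open ≡-Reasoning
    A = ↥ x ℤ.* ↥ y
    B = ↧ x ℤ.* ↧ y
    A≢0 = i*j≢0 (↥≢0 x≢0) (↥≢0 y≢0)
    B≢0 = i*j≢0 (↧≢0 x) (↧≢0 y)
    cross = cross-multiply (x ℚ.* y) (ℚ.↥-* x y) (ℚ.↧-* x y)
    νA≡ : νℤ A ≡ νℤ (↥ x) + νℤ (↥ y)
    νA≡ = νℤ-* (↥≢0 x≢0) (↥≢0 y≢0)
    νB≡ : νℤ B ≡ ν (↧ₙ x) + ν (↧ₙ y)
    νB≡ = νℤ-* (↧≢0 x) (↧≢0 y)
    regroup : ∀ a b c d → + (a + b) ℤ.- + (c + d) ≡ (+ a ℤ.- + c) ℤ.+ (+ b ℤ.- + d)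
    regroup a b c d = trans (cong₂ ℤ._-_ (ℤ.pos-+ a b) (ℤ.pos-+ c d)) (ring (+ a) (+ b) (+ c) (+ d))
      where
      ring : ∀ a b c d → (a ℤ.+ b) ℤ.- (c ℤ.+ d) ≡ (a ℤ.- c) ℤ.+ (b ℤ.- d)
      ring = ℤ-Solver.solve-∀

  module _ {x y : ℚ} (x≢0 : x ≢ 0ℚ) (y≢0 : y ≢ 0ℚ) where
    private
      A  = ↥ x ℤ.* ↧ y
      A′ = ↥ y ℤ.* ↧ x
      B  = ↧ x ℤ.* ↧ y
      B≢0 = i*j≢0 (↧≢0 x) (↧≢0 y)

      νℚx≡ : νℚ x ≡ + νℤ A ℤ.- + νℤ B
      νℚx≡ = νℚ-ratio x (i*j≢0 (↥≢0 x≢0) (↧≢0 y)) B≢0 (ℤ*.x∙yz≈xz∙y (↥ x) (↧ x) (↧ y))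

      νℚy≡ : νℚ y ≡ + νℤ A′ ℤ.- + νℤ B
      νℚy≡ = νℚ-ratio y (i*j≢0 (↥≢0 y≢0) (↧≢0 x)) B≢0 (sym (ℤ.*-assoc (↥ y) (↧ x) (↧ y)))

      cross : ↥ (x ℚ.+ y) ℤ.* B ≡ (A ℤ.+ A′) ℤ.* ↧ (x ℚ.+ y)
      cross = cross-multiply (x ℚ.+ y) (ℚ.↥-+ x y) (ℚ.↧-+ x y)

      νℚ[x+y]≡ : A ℤ.+ A′ ≢ 0ℤ → νℚ (x ℚ.+ y) ≡ + νℤ (A ℤ.+ A′) ℤ.- + νℤ B
      νℚ[x+y]≡ A+A′≢0 = νℚ-ratio (x ℚ.+ y) A+A′≢0 B≢0 cross

    νℚ-+ : x ℚ.+ y ≢ 0ℚ → νℚ x ℤ.≤ νℚ y → νℚ x ℤ.≤ νℚ (x ℚ.+ y)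
    νℚ-+ x+y≢0 νx≤νy = subst₂ ℤ._≤_ (sym νℚx≡) (sym (νℚ[x+y]≡ A+A′≢0))
      (ℤ.+-monoˡ-≤ (ℤ.- + νℤ B) (+≤+ (νℤ-+ {A} {A′} νA≤νA′ A+A′≢0)))
      where
      νA≤νA′ : νℤ A ≤ νℤ A′
      νA≤νA′ = m-k≤n-k⇒m≤n (νℤ B) (subst₂ ℤ._≤_ νℚx≡ νℚy≡ νx≤νy)
      A+A′≢0 : A ℤ.+ A′ ≢ 0ℤ
      A+A′≢0 A+A′≡0 = i*j≢0 (↥≢0 x+y≢0) B≢0 (trans cross (cong (ℤ._* ↧ (x ℚ.+ y)) A+A′≡0))

    νℚ-+-< : νℚ x ℤ.< νℚ y → x ℚ.+ y ≢ 0ℚ × νℚ (x ℚ.+ y) ≡ νℚ x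
    νℚ-+-< νx<νy = x+y≢0 , (begin
      νℚ (x ℚ.+ y)                     ≡⟨ νℚ[x+y]≡ A+A′≢0 ⟩
      + νℤ (A ℤ.+ A′) ℤ.- + νℤ B       ≡⟨ cong (λ a → + a ℤ.- + νℤ B) νA+A′≡νA ⟩
      + νℤ A ℤ.- + νℤ B                ≡⟨ νℚx≡ ⟨
      νℚ x                             ∎)
      where
      open ≡-Reasoning
      νA<νA′ : νℤ A < νℤ A′
      νA<νA′ = m-k<n-k⇒m<n (νℤ B) (subst₂ ℤ._<_ νℚx≡ νℚy≡ νx<νy)
      strict : A ℤ.+ A′ ≢ 0ℤ × νℤ (A ℤ.+ A′) ≡ νℤ A
      strict = νℤ-+-< {A} {A′} (i*j≢0 (↥≢0 x≢0) (↧≢0 y)) νA<νA′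
      A+A′≢0 = proj₁ strict
      νA+A′≡νA = proj₂ strict
      x+y≢0 : x ℚ.+ y ≢ 0ℚ
      x+y≢0 x+y≡0 = ratio-↥≢0 (x ℚ.+ y) A+A′≢0 cross (cong ↥_ x+y≡0)

  νℚ-ℕ→ℚ : ∀ {m} → m ≢ 0 → ℕ→ℚ m ≢ 0ℚ × νℚ (ℕ→ℚ m) ≡ + ν m
  νℚ-ℕ→ℚ {m} m≢0 = m≢0ℚ , trans (νℚ-ratio (ℕ→ℚ m) +m≢0 (λ ()) cross)
                                   (trans (cong (λ k → + ν m ℤ.- + k) ν-1) (ℤ.+-identityʳ (+ ν m)))
    where
    +m≢0 : + m ≢ 0ℤ
    +m≢0 = m≢0 ∘ ℤ.+-injective
    cross = cross-multiply (ℕ→ℚ m) (ℚ.↥-/ (+ m) 1) (ℚ.↧-/ (+ m) 1)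
    m≢0ℚ : ℕ→ℚ m ≢ 0ℚ
    m≢0ℚ m≡0 = ratio-↥≢0 (ℕ→ℚ m) +m≢0 cross (cong ↥_ m≡0)

  νℚ-neg : ∀ x → νℚ (ℚ.- x) ≡ νℚ x
  νℚ-neg x = cong₂ (λ a b → + ν a ℤ.- + ν b)
    (trans (cong ∣_∣ (ℚ.↥-neg x)) (ℤ.∣-i∣≡∣i∣ (↥ x))) (ℤ.+-injective (ℚ.↧-neg x))

  νℚ-signℚ : ∀ j {x} → x ≢ 0ℚ → signℚ j ℚ.* x ≢ 0ℚ × νℚ (signℚ j ℚ.* x) ≡ νℚ x
  νℚ-signℚ zero    {x} x≢0 = subst (_≢ 0ℚ) (sym (ℚ.*-identityˡ x)) x≢0 , cong νℚ (ℚ.*-identityˡ x)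
  νℚ-signℚ (suc j) {x} x≢0 with νℚ-signℚ j x≢0
  ... | ±x≢0 , ν±x≡νx =
    subst (_≢ 0ℚ) -±x≡ (±x≢0 ∘ ℚ.neg-injective) , trans (cong νℚ (sym -±x≡)) (trans (νℚ-neg (signℚ j ℚ.* x)) ν±x≡νx)
    where
    -±x≡ : ℚ.- (signℚ j ℚ.* x) ≡ signℚ (suc j) ℚ.* x
    -±x≡ = ℚ.neg-distribˡ-* (signℚ j) x

-- Polynomials as coefficient lists

sumUpTo : (ℕ → ℚ) → ℕ → ℚ
sumUpTo F n = sumℚ (applyUpTo F n)

sumUpTo-zero : ∀ n {F} → (∀ i → i < n → F i ≡ 0ℚ) → sumUpTo F n ≡ 0ℚ
sumUpTo-zero zero    _    = refl
sumUpTo-zero (suc n) F≡0 = cong₂ ℚ._+_ (F≡0 0 z<s) (sumUpTo-zero n (λ i → F≡0 (suc i) ∘ s<s))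

sumUpTo-single : ∀ n {F i₀} → i₀ < n → (∀ i → i < n → i ≢ i₀ → F i ≡ 0ℚ) → sumUpTo F n ≡ F i₀
sumUpTo-single (suc n) {F} {zero}   _          F≡0 =
  trans (cong (F 0 ℚ.+_) (sumUpTo-zero n (λ i i<n → F≡0 (suc i) (s<s i<n) λ ()))) (ℚ.+-identityʳ (F 0))
sumUpTo-single (suc n) {F} {suc i₀} (s<s i₀<n) F≡0 =
  trans (cong₂ ℚ._+_ (F≡0 0 z<s λ ())
               (sumUpTo-single n i₀<n λ i i<n i≢i₀ → F≡0 (suc i) (s<s i<n) (i≢i₀ ∘ suc-injective)))
        (ℚ.+-identityˡ (F (suc i₀)))

coeff-applyUpTo : ∀ G {n j} → j < n → coeff (applyUpTo G n) j ≡ G j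
coeff-applyUpTo G {suc n} {zero}  _         = refl
coeff-applyUpTo G {suc n} {suc j} (s<s j<n) = coeff-applyUpTo (G ∘ suc) j<n

coeff-applyUpTo-≥ : ∀ G {n j} → n ≤ j → coeff (applyUpTo G n) j ≡ 0ℚ
coeff-applyUpTo-≥ G {zero}            _         = refl
coeff-applyUpTo-≥ G {suc n} {suc j} (s≤s n≤j) = coeff-applyUpTo-≥ (G ∘ suc) n≤j

IsZero : Poly → Set
IsZero g = ∀ i → coeff g i ≡ 0ℚ

mulCoeff≡sumUpTo : ∀ g h k → mulCoeff g h k ≡ sumUpTo (λ i → coeff g i ℚ.* coeff h (k ∸ i)) (suc k)
mulCoeff≡sumUpTo g h k = cong sumℚ (map-upTo (λ i → coeff g i ℚ.* coeff h (k ∸ i)) (suc k))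

mulCoeff-vanishes : ∀ g h k → (∀ i → i ≤ k → coeff g i ≡ 0ℚ ⊎ coeff h (k ∸ i) ≡ 0ℚ) → mulCoeff g h k ≡ 0ℚ
mulCoeff-vanishes g h k term≡0 =
  trans (mulCoeff≡sumUpTo g h k) (sumUpTo-zero (suc k) λ i i≤k → x*y≡0 {coeff g i} (term≡0 i (s≤s⁻¹ i≤k)))

record Degree (g : Poly) : Set where
  field
    degree         : ℕ
    leading≢0      : coeff g degree ≢ 0ℚ
    vanishes-above : ∀ i → degree < i → coeff g i ≡ 0ℚ

zero-or-degree : ∀ g → IsZero g ⊎ Degree g
zero-or-degree []      = inj₁ λ _ → refl
zero-or-degree (a ∷ g) with zero-or-degree g | a ℚ.≟ 0ℚ
... | inj₂ D   | _       = inj₂ record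
  { degree = suc degree ; leading≢0 = leading≢0 ; vanishes-above = λ { (suc i) (s<s d<i) → vanishes-above i d<i } }
  where open Degree D
... | inj₁ g≡0 | yes a≡0 = inj₁ λ { zero → a≡0 ; (suc i) → g≡0 i }
... | inj₁ g≡0 | no a≢0  = inj₂ record
  { degree = 0 ; leading≢0 = a≢0 ; vanishes-above = λ { (suc i) _ → g≡0 i } }

module _ {g h : Poly} (G : Degree g) (H : Degree h) where
  open Degree G renaming (degree to d; vanishes-above to g-above)
  open Degree H renaming (degree to e; vanishes-above to h-above)

  private
    term-vanishes : ∀ {i j} → d < i ⊎ e < j → coeff g i ≡ 0ℚ ⊎ coeff h j ≡ 0ℚ
    term-vanishes = Sum.map (g-above _) (h-above _)

  mulCoeff-above-degree : ∀ {k} → d + e < k → mulCoeff g h k ≡ 0ℚ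
  mulCoeff-above-degree {k} d+e<k = mulCoeff-vanishes g h k λ i _ → term-vanishes (outside i)
    where
    e<k∸d : e < k ∸ d
    e<k∸d = m+n≤o⇒m≤o∸n (suc e) (subst (_≤ k) (cong suc (+-comm d e)) d+e<k)
    outside : ∀ i → d < i ⊎ e < k ∸ i
    outside i with d <? i
    ... | yes d<i = inj₁ d<i
    ... | no  d≮i = inj₂ (<-≤-trans e<k∸d (∸-monoʳ-≤ k (≮⇒≥ d≮i)))

  mulCoeff-degree : mulCoeff g h (d + e) ≡ coeff g d ℚ.* coeff h e
  mulCoeff-degree = begin
    mulCoeff g h (d + e)                                             ≡⟨ mulCoeff≡sumUpTo g h (d + e) ⟩
    sumUpTo (λ i → coeff g i ℚ.* coeff h (d + e ∸ i)) (suc (d + e)) ≡⟨ sumUpTo-single _ (s≤s (m≤m+n d e)) others ⟩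
    coeff g d ℚ.* coeff h (d + e ∸ d)                                ≡⟨ cong ((coeff g d ℚ.*_) ∘ coeff h) (m+n∸m≡n d e) ⟩
    coeff g d ℚ.* coeff h e                                          ∎
    where
    open ≡-Reasoning
    others : ∀ i → i < suc (d + e) → i ≢ d → coeff g i ℚ.* coeff h (d + e ∸ i) ≡ 0ℚ
    others i _ i≢d with <-cmp i d
    ... | tri< i<d _ _ = x*y≡0 (term-vanishes (inj₂ (subst (_< d + e ∸ i) (m+n∸m≡n d e) (∸-monoʳ-< i<d (m≤m+n d e)))))
    ... | tri≈ _ i≡d _ = contradiction i≡d i≢d
    ... | tri> _ _ d<i = x*y≡0 (term-vanishes (inj₁ d<i))

record FirstMinimum (w : ℚ → ℕ → ℤ) (g : Poly) : Set where
  field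
    index        : ℕ
    minimum      : ℤ
    index≢0      : coeff g index ≢ 0ℚ
    weight-index : w (coeff g index) index ≡ minimum
    minimal      : ∀ i → coeff g i ≢ 0ℚ → minimum ℤ.≤ w (coeff g i) i
    first        : ∀ i → i < index → coeff g i ≢ 0ℚ → minimum ℤ.< w (coeff g i) i

firstMinimum-head : ∀ {w a g} → a ≢ 0ℚ → (∀ i → coeff g i ≢ 0ℚ → w a 0 ℤ.≤ w (coeff g i) (suc i)) →
                    FirstMinimum w (a ∷ g)
firstMinimum-head {w} {a} a≢0 a≤g = record
  { index = 0 ; minimum = w a 0 ; index≢0 = a≢0 ; weight-index = refl
  ; minimal = λ { zero _ → ℤ.≤-refl ; (suc i) → a≤g i } ; first = λ _ () }

firstMinimum-tail : ∀ {w a g} (M : FirstMinimum (λ x i → w x (suc i)) g) →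
                    (a ≢ 0ℚ → FirstMinimum.minimum M ℤ.< w a 0) → FirstMinimum w (a ∷ g)
firstMinimum-tail M M<a = record
  { index = suc index ; minimum = minimum ; index≢0 = index≢0 ; weight-index = weight-index
  ; minimal = λ { zero a≢0 → ℤ.<⇒≤ (M<a a≢0) ; (suc i) → minimal i }
  ; first = λ { zero _ a≢0 → M<a a≢0 ; (suc i) (s<s i<l) → first i i<l } }
  where open FirstMinimum M

zero-or-firstMinimum : ∀ w g → IsZero g ⊎ FirstMinimum w g
zero-or-firstMinimum w []      = inj₁ λ _ → refl
zero-or-firstMinimum w (a ∷ g) with zero-or-firstMinimum (λ x i → w x (suc i)) g | a ℚ.≟ 0ℚ
... | inj₁ g≡0 | yes a≡0 = inj₁ λ { zero → a≡0 ; (suc i) → g≡0 i }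
... | inj₁ g≡0 | no  a≢0 = inj₂ (firstMinimum-head a≢0 λ i gᵢ≢0 → contradiction (g≡0 i) gᵢ≢0)
... | inj₂ M   | yes a≡0 = inj₂ (firstMinimum-tail M λ a≢0 → contradiction a≡0 a≢0)
... | inj₂ M   | no  a≢0 with w a 0 ℤ.≤? FirstMinimum.minimum M
...   | yes a≤M = inj₂ (firstMinimum-head a≢0 λ i gᵢ≢0 → ℤ.≤-trans a≤M (FirstMinimum.minimal M i gᵢ≢0))
...   | no  a≰M = inj₂ (firstMinimum-tail M λ _ → ℤ.≰⇒> a≰M)

nonZero⇒Degree : ∀ {g} → ¬ IsZero g → Degree g
nonZero⇒Degree {g} g≢0 = [ (λ g≡0 → contradiction g≡0 g≢0) , id ]′ (zero-or-degree g)

nonZero⇒FirstMinimum : ∀ w {g} → ¬ IsZero g → FirstMinimum w g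
nonZero⇒FirstMinimum w {g} g≢0 = [ (λ g≡0 → contradiction g≡0 g≢0) , id ]′ (zero-or-firstMinimum w g)

mulCoeff-0 : ∀ g h → mulCoeff g h 0 ≡ coeff g 0 ℚ.* coeff h 0
mulCoeff-0 g h = ℚ.+-identityʳ (coeff g 0 ℚ.* coeff h 0)

module Dumas (p : ℕ) (p-prime : Prime p) (N c : ℕ) where
  open Valuation p p-prime

  -- The point (k, ν x) lies on or above the segment from (0, c) to (N, 0) iff weight x k ≥ N·c.
  weight : ℚ → ℕ → ℤ
  weight x k = + N ℤ.* νℚ x ℤ.+ + (c * k)

  weight-* : ∀ {x y i j k} → i + j ≡ k → x ≢ 0ℚ → y ≢ 0ℚ → weight (x ℚ.* y) k ≡ weight x i ℤ.+ weight y j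
  weight-* {x} {y} {i} {j} refl x≢0 y≢0 = begin
    + N ℤ.* νℚ (x ℚ.* y) ℤ.+ + (c * (i + j))               ≡⟨ cong₂ (λ v w → + N ℤ.* v ℤ.+ w) (νℚ-* x≢0 y≢0) c*[i+j]≡ ⟩
    + N ℤ.* (νℚ x ℤ.+ νℚ y) ℤ.+ (+ (c * i) ℤ.+ + (c * j))  ≡⟨ regroup (+ N) (νℚ x) (νℚ y) (+ (c * i)) (+ (c * j)) ⟩
    weight x i ℤ.+ weight y j                               ∎
    where
    open ≡-Reasoning
    c*[i+j]≡ : + (c * (i + j)) ≡ + (c * i) ℤ.+ + (c * j)
    c*[i+j]≡ = trans (cong +_ (*-distribˡ-+ c i j)) (ℤ.pos-+ (c * i) (c * j))
    regroup : ∀ n a b s t → n ℤ.* (a ℤ.+ b) ℤ.+ (s ℤ.+ t) ≡ (n ℤ.* a ℤ.+ s) ℤ.+ (n ℤ.* b ℤ.+ t)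
    regroup = ℤ-Solver.solve-∀

  weight-mono-≤ : ∀ {x y} k → νℚ x ℤ.≤ νℚ y → weight x k ℤ.≤ weight y k
  weight-mono-≤ k νx≤νy = ℤ.+-monoˡ-≤ (+ (c * k)) (ℤ.*-monoˡ-≤-nonNeg (+ N) νx≤νy)

  weight-cancel-< : ∀ {x y} k → weight x k ℤ.< weight y k → νℚ x ℤ.< νℚ y
  weight-cancel-< {x} {y} k wx<wy = ℤ.≰⇒> λ νy≤νx → ℤ.<⇒≱ wx<wy (weight-mono-≤ {y} {x} k νy≤νx)

  WeightAtLeast : ℤ → ℕ → ℚ → Set
  WeightAtLeast M k x = x ≢ 0ℚ → M ℤ.≤ weight x k

  HasWeight : ℤ → ℕ → ℚ → Set
  HasWeight E k x = x ≢ 0ℚ × weight x k ≡ E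

  weightAtLeast-+ : ∀ {M k x y} → WeightAtLeast M k x → WeightAtLeast M k y → WeightAtLeast M k (x ℚ.+ y)
  weightAtLeast-+ {M} {k} {x} {y} x≥M y≥M x+y≢0 with x ℚ.≟ 0ℚ | y ℚ.≟ 0ℚ
  ... | yes refl | _        = subst (WeightAtLeast M k) (sym (ℚ.+-identityˡ y)) y≥M x+y≢0
  ... | no  x≢0  | yes refl = subst (WeightAtLeast M k) (sym (ℚ.+-identityʳ x)) x≥M x+y≢0
  ... | no  x≢0  | no  y≢0 with ℤ.≤-total (νℚ x) (νℚ y)
  ...   | inj₁ νx≤νy = ℤ.≤-trans (x≥M x≢0) (weight-mono-≤ {x} {x ℚ.+ y} k (νℚ-+ x≢0 y≢0 x+y≢0 νx≤νy))
  ...   | inj₂ νy≤νx = ℤ.≤-trans (y≥M y≢0) (weight-mono-≤ {y} {x ℚ.+ y} k (subst (λ z → νℚ y ℤ.≤ νℚ z)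
                         (ℚ.+-comm y x) (νℚ-+ y≢0 x≢0 (x+y≢0 ∘ trans (ℚ.+-comm x y)) νy≤νx)))

  weightAtLeast-sum : ∀ {M k} n {F} → (∀ i → i < n → WeightAtLeast M k (F i)) → WeightAtLeast M k (sumUpTo F n)
  weightAtLeast-sum zero    _   0≢0 = contradiction refl 0≢0
  weightAtLeast-sum (suc n) F≥M = weightAtLeast-+ (F≥M 0 z<s) (weightAtLeast-sum n λ i → F≥M (suc i) ∘ s<s)

  hasWeight-+ : ∀ {E k x y} → HasWeight E k x → WeightAtLeast (ℤ.suc E) k y → HasWeight E k (x ℚ.+ y)
  hasWeight-+ {E} {k} {x} {y} (x≢0 , wx≡E) y>E with y ℚ.≟ 0ℚ
  ... | yes refl = subst (HasWeight E k) (sym (ℚ.+-identityʳ x)) (x≢0 , wx≡E)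
  ... | no  y≢0  = proj₁ strict , trans (cong (λ v → + N ℤ.* v ℤ.+ + (c * k)) (proj₂ strict)) wx≡E
    where
    wx<wy : weight x k ℤ.< weight y k
    wx<wy = subst (ℤ._< weight y k) (sym wx≡E) (ℤ.suc[i]≤j⇒i<j (y>E y≢0))
    strict = νℚ-+-< x≢0 y≢0 (weight-cancel-< {x} {y} k wx<wy)

  hasWeight-sum : ∀ {E k} n {F i₀} → i₀ < n → HasWeight E k (F i₀) →
                  (∀ i → i < n → i ≢ i₀ → WeightAtLeast (ℤ.suc E) k (F i)) → HasWeight E k (sumUpTo F n)
  hasWeight-sum (suc n) {F} {zero}   _          F₀≡E Fᵢ>E =
    hasWeight-+ F₀≡E (weightAtLeast-sum n λ i i<n → Fᵢ>E (suc i) (s<s i<n) λ ())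
  hasWeight-sum (suc n) {F} {suc i₀} (s<s i₀<n) Fᵢ₀≡E Fᵢ>E =
    subst (HasWeight _ _) (ℚ.+-comm _ (F 0)) (hasWeight-+
      (hasWeight-sum n i₀<n Fᵢ₀≡E λ i i<n i≢i₀ → Fᵢ>E (suc i) (s<s i<n) (i≢i₀ ∘ suc-injective))
      (Fᵢ>E 0 z<s λ ()))

  weight-≡⇒N∣c*k : ∀ {x y} k → weight x k ≡ weight y 0 → N ∣ c * k
  weight-≡⇒N∣c*k {x} {y} k wx≡wy = ℤ∣.∣⇒∣ᵤ (ℤ∣.divides (νℚ y ℤ.- νℚ x) (begin
    + (c * k)                                     ≡⟨ cancel (+ N ℤ.* νℚ x) (+ (c * k)) ⟩
    weight x k ℤ.- + N ℤ.* νℚ x                  ≡⟨ cong (ℤ._- + N ℤ.* νℚ x) wx≡wy ⟩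
    weight y 0 ℤ.- + N ℤ.* νℚ x                  ≡⟨ cong (λ t → + N ℤ.* νℚ y ℤ.+ + t ℤ.- + N ℤ.* νℚ x) (*-zeroʳ c) ⟩
    + N ℤ.* νℚ y ℤ.+ 0ℤ ℤ.- + N ℤ.* νℚ x          ≡⟨ factor (+ N) (νℚ x) (νℚ y) ⟩
    (νℚ y ℤ.- νℚ x) ℤ.* + N                       ∎))
    where
    open ≡-Reasoning
    cancel : ∀ a b → b ≡ a ℤ.+ b ℤ.- a
    cancel = ℤ-Solver.solve-∀
    factor : ∀ n a b → n ℤ.* b ℤ.+ 0ℤ ℤ.- n ℤ.* a ≡ (b ℤ.- a) ℤ.* n
    factor = ℤ-Solver.solve-∀

  module _ {g h : Poly} (G : FirstMinimum weight g) (H : FirstMinimum weight h) where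
    open FirstMinimum G renaming (index to l; minimum to m; index≢0 to gₗ≢0; weight-index to w[gₗ]≡m;
                                  minimal to g-minimal; first to g-first)
    open FirstMinimum H renaming (index to l′; minimum to m′; index≢0 to hₗ′≢0; weight-index to w[hₗ′]≡m′;
                                  minimal to h-minimal; first to h-first)

    -- Gauss's lemma for the weight: in the convolution at l + l′ only the term i = l is minimal.
    mulCoeff-hasWeight : HasWeight (m ℤ.+ m′) (l + l′) (mulCoeff g h (l + l′))
    mulCoeff-hasWeight = subst (HasWeight _ _) (sym (mulCoeff≡sumUpTo g h (l + l′)))
      (hasWeight-sum (suc (l + l′)) (s≤s (m≤m+n l l′)) term-l others)
      where
      K∸l≡l′ : l + l′ ∸ l ≡ l′
      K∸l≡l′ = m+n∸m≡n l l′
      term-l : HasWeight (m ℤ.+ m′) (l + l′) (coeff g l ℚ.* coeff h (l + l′ ∸ l))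
      term-l rewrite K∸l≡l′ = x*y≢0 gₗ≢0 hₗ′≢0 , trans (weight-* refl gₗ≢0 hₗ′≢0) (cong₂ ℤ._+_ w[gₗ]≡m w[hₗ′]≡m′)
      others : ∀ i → i < suc (l + l′) → i ≢ l →
               WeightAtLeast (ℤ.suc (m ℤ.+ m′)) (l + l′) (coeff g i ℚ.* coeff h (l + l′ ∸ i))
      others i i≤K i≢l term≢0 =
        ℤ.i<j⇒suc[i]≤j (subst (m ℤ.+ m′ ℤ.<_) (sym (weight-* (m+[n∸m]≡n (s≤s⁻¹ i≤K)) gᵢ≢0 hⱼ≢0)) bound)
        where
        gᵢ≢0 = proj₁ (factors≢0 {coeff g i} term≢0)
        hⱼ≢0 = proj₂ (factors≢0 {coeff g i} term≢0)
        bound : m ℤ.+ m′ ℤ.< weight (coeff g i) i ℤ.+ weight (coeff h (l + l′ ∸ i)) (l + l′ ∸ i)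
        bound with <-cmp i l
        ... | tri< i<l _ _ = ℤ.+-mono-<-≤ (g-first i i<l gᵢ≢0) (h-minimal _ hⱼ≢0)
        ... | tri≈ _ i≡l _ = contradiction i≡l i≢l
        ... | tri> _ _ l<i = ℤ.+-mono-≤-< (g-minimal i gᵢ≢0)
                               (h-first _ (subst (l + l′ ∸ i <_) K∸l≡l′ (∸-monoʳ-< l<i (s≤s⁻¹ i≤K))) hⱼ≢0)

  module _ (N≥1 : 1 ≤ N) (N∣c*d⇒N∣d : ∀ d → N ∣ c * d → N ∣ d) (f : Poly)
           (f-vanishes-above : ∀ j → N < j → coeff f j ≡ 0ℚ)
           (f₀≢0 : coeff f 0 ≢ 0ℚ) (weight-f₀ : weight (coeff f 0) 0 ≡ + (N * c))
           (f_N≢0 : coeff f N ≢ 0ℚ) (weight-f_N : weight (coeff f N) N ≡ + (N * c))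
           (f-above : ∀ j → coeff f j ≢ 0ℚ → + (N * c) ℤ.≤ weight (coeff f j) j) where

    module _ {g h : Poly} (g*h≡f : IsProduct g h f) where
      private
        g≢0 : ¬ IsZero g
        g≢0 g≡0 = f_N≢0 (trans (sym (g*h≡f N)) (mulCoeff-vanishes g h N λ i _ → inj₁ (g≡0 i)))
        h≢0 : ¬ IsZero h
        h≢0 h≡0 = f_N≢0 (trans (sym (g*h≡f N)) (mulCoeff-vanishes g h N λ i _ → inj₂ (h≡0 (N ∸ i))))
        G = nonZero⇒Degree {g} g≢0
        H = nonZero⇒Degree {h} h≢0
        MG = nonZero⇒FirstMinimum weight {g} g≢0
        MH = nonZero⇒FirstMinimum weight {h} h≢0
        open Degree G renaming (degree to d; leading≢0 to g_d≢0; vanishes-above to g-above)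
        open Degree H renaming (degree to e; leading≢0 to h_e≢0; vanishes-above to h-above)
        open FirstMinimum MG renaming (index to l; minimum to m; minimal to g-minimal)
        open FirstMinimum MH renaming (index to l′; minimum to m′; minimal to h-minimal)

      N*c≤m+m′ : + (N * c) ℤ.≤ m ℤ.+ m′
      N*c≤m+m′ = ℤ.≤-trans (f-above (l + l′) (subst (_≢ 0ℚ) (g*h≡f (l + l′)) (proj₁ product)))
        (ℤ.≤-reflexive (trans (cong (λ z → weight z (l + l′)) (sym (g*h≡f (l + l′)))) (proj₂ product)))
        where
        product = mulCoeff-hasWeight MG MH

      degree-sum : d + e ≡ N
      degree-sum with <-cmp (d + e) N
      ... | tri< d+e<N _ _ = contradiction (trans (sym (g*h≡f N)) (mulCoeff-above-degree G H d+e<N)) f_N≢0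
      ... | tri≈ _ d+e≡N _ = d+e≡N
      ... | tri> _ _ N<d+e = contradiction
        (trans (sym (mulCoeff-degree G H)) (trans (g*h≡f (d + e)) (f-vanishes-above (d + e) N<d+e)))
        (x*y≢0 g_d≢0 h_e≢0)

      -- A product of coefficients of g and h of weight N·c ≤ m + m′ consists of minimal ones.
      weight-minimal : ∀ {i j k} → i + j ≡ k → coeff g i ℚ.* coeff h j ≡ coeff f k → coeff f k ≢ 0ℚ →
                       weight (coeff f k) k ≡ + (N * c) → weight (coeff g i) i ≡ m
      weight-minimal {i} {j} {k} i+j≡k gᵢhⱼ≡fₖ fₖ≢0 w[fₖ]≡Nc =
        ≤-+-≤⇒≡ˡ (g-minimal i gᵢ≢0) (h-minimal j hⱼ≢0) (subst (ℤ._≤ m ℤ.+ m′) w[fₖ]≡ N*c≤m+m′)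
        where
        gᵢ≢0 = proj₁ (factors≢0 {coeff g i} (subst (_≢ 0ℚ) (sym gᵢhⱼ≡fₖ) fₖ≢0))
        hⱼ≢0 = proj₂ (factors≢0 {coeff g i} (subst (_≢ 0ℚ) (sym gᵢhⱼ≡fₖ) fₖ≢0))
        w[fₖ]≡ : + (N * c) ≡ weight (coeff g i) i ℤ.+ weight (coeff h j) j
        w[fₖ]≡ = trans (sym w[fₖ]≡Nc) (trans (cong (λ z → weight z k) (sym gᵢhⱼ≡fₖ)) (weight-* i+j≡k gᵢ≢0 hⱼ≢0))

      N∣d : N ∣ d
      N∣d = N∣c*d⇒N∣d d (weight-≡⇒N∣c*k {coeff g d} {coeff g 0} d (trans weight-leading (sym weight-constant)))
        where
        weight-constant : weight (coeff g 0) 0 ≡ m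
        weight-constant = weight-minimal refl (trans (sym (mulCoeff-0 g h)) (g*h≡f 0)) f₀≢0 weight-f₀
        weight-leading : weight (coeff g d) d ≡ m
        weight-leading = weight-minimal degree-sum
          (trans (sym (mulCoeff-degree G H)) (trans (g*h≡f (d + e)) (cong (coeff f) degree-sum))) f_N≢0 weight-f_N

      factor-constant : IsConstant g ⊎ IsConstant h
      factor-constant with d ≟ 0
      ... | yes d≡0 = inj₁ λ k 1≤k → g-above k (subst (_< k) (sym d≡0) 1≤k)
      ... | no ¬d≡0 = inj₂ λ k 1≤k → h-above k (subst (_< k) (sym e≡0) 1≤k)
        where
        N≤d : N ≤ d
        N≤d = ∣⇒≤ {{≢-nonZero ¬d≡0}} N∣d
        e≡0 : e ≡ 0
        e≡0 = n≤0⇒n≡0 (subst (e ≤_) (m≤n⇒m∸n≡0 N≤d) (m+n≤o⇒m≤o∸n e (≤-reflexive (trans (+-comm e d) degree-sum))))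

    dumas-irreducible : Irreducible f
    dumas-irreducible = (λ f-constant → f_N≢0 (f-constant N N≥1)) , λ g h → factor-constant {g} {h}

P-coeff-top : ∀ u v → P-coeff u v u ≡ 1
P-coeff-top u v = cong₂ _*_ (trans (cong (λ t → (t ! / v !) {{v !≢0}}) (m+n∸m≡n u v)) (n/n≡1 (v !) {{v !≢0}}))
                            (nCn≡1 u)

P-coeff-0 : ∀ u v → P-coeff u v 0 * v ! ≡ (u + v) !
P-coeff-0 u v = trans (cong (λ c → ((u + v) ! / v !) {{v !≢0}} * c * v !) uC0≡1)
  (trans (cong (_* v !) (*-identityʳ (((u + v) ! / v !) {{v !≢0}}))) (m/n*n≡m {{v !≢0}} (m≤n⇒m!∣n! (m≤n+m v u))))
  where
  uC0≡1 : u C 0 ≡ 1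
  uC0≡1 = trans (nCk≡nC[n∸k] {n = u} z≤n) (nCn≡1 u)

Q-coeff≡P-coeff : ∀ u v j → Q-coeff u v j ≡ P-coeff v u j
Q-coeff≡P-coeff u v j = cong (λ t → ((t ∸ j) ! / u !) {{u !≢0}} * (v C j)) (+-comm u v)

module _ {u v j : ℕ} (j≤u : j ≤ u) where
  private
    T = (u + v ∸ j) !
    v≤u+v∸j : v ≤ u + v ∸ j
    v≤u+v∸j = subst (v ≤_) (sym (+-∸-comm v j≤u)) (m≤n+m v (u ∸ j))
    u+v∸j∸v≡u∸j : u + v ∸ j ∸ v ≡ u ∸ j
    u+v∸j∸v≡u∸j = trans (cong (_∸ v) (+-∸-comm v j≤u)) (m+n∸n≡m (u ∸ j) v)

  P-coeff-identity : P-coeff u v j * j ! * (v ! * (u ∸ j) !) ≡ T * u !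
  P-coeff-identity =
    trans (regroup (T / v !) (u C j) (j !) (v !) ((u ∸ j) !)) (cong₂ _*_ T/v!*v!≡T uCj*j!*[u∸j]!≡u!)
    where
    instance _ = v !≢0
    T/v!*v!≡T : T / v ! * v ! ≡ T
    T/v!*v!≡T = m/n*n≡m (m≤n⇒m!∣n! v≤u+v∸j)
    uCj*j!*[u∸j]!≡u! : (u C j) * (j ! * (u ∸ j) !) ≡ u !
    uCj*j!*[u∸j]!≡u! = trans (cong (_* (j ! * (u ∸ j) !)) (nCk≡n!/k![n-k]! j≤u))
                             (m/n*n≡m {{j !* (u ∸ j) !≢0}} (k![n∸k]!∣n! j≤u))
    regroup : ∀ a c x y z → a * c * x * (y * z) ≡ (a * y) * (c * (x * z))
    regroup = ℕ-Solver.solve-∀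

  P-coeff≢0 : P-coeff u v j ≢ 0
  P-coeff≢0 P≡0 = ≢-nonZero⁻¹ (T * u !) {{m*n≢0 T (u !) {{(u + v ∸ j) !≢0}} {{u !≢0}}}}
    (trans (sym P-coeff-identity) (cong (λ x → x * j ! * (v ! * (u ∸ j) !)) P≡0))

  u!∣P-coeff*j! : u ! ∣ P-coeff u v j * j !
  u!∣P-coeff*j! with subst (λ t → v ! * t ! ∣ T) u+v∸j∸v≡u∸j (k![n∸k]!∣n! v≤u+v∸j)
  ... | divides K T≡K*X = divides K (*-cancelʳ-≡ _ _ X {{v !* (u ∸ j) !≢0}} (begin
    P-coeff u v j * j ! * X   ≡⟨ P-coeff-identity ⟩
    T * u !                   ≡⟨ cong (_* u !) T≡K*X ⟩
    K * X * u !               ≡⟨ ℕ*.xy∙z≈xz∙y K X (u !) ⟩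
    K * u ! * X               ∎))
    where
    open ≡-Reasoning
    X = v ! * (u ∸ j) !

-- Legendre's formula

module Factorial (p : ℕ) (p-prime : Prime p) where
  open Valuation p p-prime

  n!≢0 : ∀ n → n ! ≢ 0
  n!≢0 n = ≢-nonZero⁻¹ (n !) {{n !≢0}}

  ν-[1+n]! : ∀ n → ν (suc n !) ≡ ν (suc n) + ν (n !)
  ν-[1+n]! n = ν-* (λ ()) (n!≢0 n)

  p∤⇒ν-[1+n]! : ∀ {n} → p ∤ suc n → ν (suc n !) ≡ ν (n !)
  p∤⇒ν-[1+n]! {n} p∤ = trans (ν-[1+n]! n) (cong (_+ ν (n !)) (p∤⇒ν≡0 p∤))

  ν-[pk+r]! : ∀ k {r} → r < p → ν ((p * k + r) !) ≡ ν ((p * k) !)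
  ν-[pk+r]! k {zero}  _   = cong (λ m → ν (m !)) (+-identityʳ (p * k))
  ν-[pk+r]! k {suc r} r<p = begin
    ν ((p * k + suc r) !)   ≡⟨ cong (λ m → ν (m !)) (+-suc (p * k) r) ⟩
    ν (suc (p * k + r) !)   ≡⟨ p∤⇒ν-[1+n]! p∤ ⟩
    ν ((p * k + r) !)       ≡⟨ ν-[pk+r]! k (<-trans (n<1+n r) r<p) ⟩
    ν ((p * k) !)           ∎
    where
    open ≡-Reasoning
    p∤ : p ∤ suc (p * k + r)
    p∤ p∣ = <⇒≱ r<p (∣⇒≤ (∣m+n∣m⇒∣n (subst (p ∣_) (sym (+-suc (p * k) r)) p∣) (m∣m*n k)))

  p*[1+k]≡ : ∀ k → p * suc k ≡ suc (p * k + (p ∸ 1))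
  p*[1+k]≡ k = begin
    p * suc k              ≡⟨ *-suc p k ⟩
    p + p * k              ≡⟨ cong (_+ p * k) (suc-pred p) ⟨
    suc (p ∸ 1 + p * k)    ≡⟨ cong suc (+-comm (p ∸ 1) (p * k)) ⟩
    suc (p * k + (p ∸ 1))  ∎
    where open ≡-Reasoning

  ν-[pk]! : ∀ k → ν ((p * k) !) ≡ k + ν (k !)
  ν-[pk]! zero    = cong (λ m → ν (m !)) (*-zeroʳ p)
  ν-[pk]! (suc k) = begin
    ν ((p * suc k) !)                                  ≡⟨ cong (λ m → ν (m !)) (p*[1+k]≡ k) ⟩
    ν (suc (p * k + (p ∸ 1)) !)                        ≡⟨ ν-[1+n]! _ ⟩
    ν (suc (p * k + (p ∸ 1))) + ν ((p * k + (p ∸ 1)) !) ≡⟨ cong₂ _+_ (cong ν (sym (p*[1+k]≡ k))) (ν-[pk+r]! k p∸1<p) ⟩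
    ν (p * suc k) + ν ((p * k) !)                      ≡⟨ cong₂ _+_ (ν-* p≢0 (λ ())) (ν-[pk]! k) ⟩
    (ν p + ν (suc k)) + (k + ν (k !))                  ≡⟨ cong (λ x → (x + ν (suc k)) + (k + ν (k !))) ν-p ⟩
    suc (ν (suc k) + (k + ν (k !)))                    ≡⟨ cong suc (swap (ν (suc k)) k (ν (k !))) ⟩
    suc (k + (ν (suc k) + ν (k !)))                    ≡⟨ cong (λ x → suc (k + x)) (ν-[1+n]! k) ⟨
    suc k + ν (suc k !)                                ∎
    where
    open ≡-Reasoning
    p≢0 : p ≢ 0
    p≢0 = ≢-nonZero⁻¹ p
    p∸1<p : p ∸ 1 < p
    p∸1<p = subst (p ∸ 1 <_) (suc-pred p) (n<1+n (p ∸ 1))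
    swap : ∀ a b c → a + (b + c) ≡ b + (a + c)
    swap = ℕ-Solver.solve-∀

  ν-[pk+r]!≡ : ∀ k {r} → r < p → ν ((p * k + r) !) ≡ k + ν (k !)
  ν-[pk+r]!≡ k r<p = trans (ν-[pk+r]! k r<p) (ν-[pk]! k)

  ν-small! : ∀ {a} → a < p → ν (a !) ≡ 0
  ν-small! {a} a<p = trans (cong (λ m → ν (m !)) (cong (_+ a) (sym (*-zeroʳ p)))) (trans (ν-[pk+r]!≡ 0 a<p) ν-1)

  [p∸1]*k+k≡p*k : ∀ k → (p ∸ 1) * k + k ≡ p * k
  [p∸1]*k+k≡p*k k = trans (+-comm ((p ∸ 1) * k) k) (cong (_* k) (suc-pred p))

  [p∸1]*ν[pk+r]!<pk+r : ∀ k {r} → r < p → 0 < p * k + r → (0 < k → (p ∸ 1) * ν (k !) < k) →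
                        (p ∸ 1) * ν ((p * k + r) !) < p * k + r
  [p∸1]*ν[pk+r]!<pk+r zero {r} r<p 0<r _ =
    subst (_< p * 0 + r) (sym (trans (cong ((p ∸ 1) *_) (trans (ν-[pk+r]!≡ 0 r<p) ν-1)) (*-zeroʳ (p ∸ 1)))) 0<r
  [p∸1]*ν[pk+r]!<pk+r k@(suc _) {r} r<p _ ih = begin-strict
    (p ∸ 1) * ν ((p * k + r) !)          ≡⟨ cong ((p ∸ 1) *_) (ν-[pk+r]!≡ k r<p) ⟩
    (p ∸ 1) * (k + ν (k !))              ≡⟨ *-distribˡ-+ (p ∸ 1) k (ν (k !)) ⟩
    (p ∸ 1) * k + (p ∸ 1) * ν (k !)      <⟨ +-monoʳ-< ((p ∸ 1) * k) (ih z<s) ⟩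
    (p ∸ 1) * k + k                      ≡⟨ [p∸1]*k+k≡p*k k ⟩
    p * k                                ≤⟨ m≤m+n (p * k) r ⟩
    p * k + r                            ∎
    where open ≤-Reasoning

  [p∸1]*ν[n!]<n : ∀ n → 0 < n → (p ∸ 1) * ν (n !) < n
  [p∸1]*ν[n!]<n = <-rec (λ n → 0 < n → (p ∸ 1) * ν (n !) < n) go
    where
    go : ∀ n → (∀ {k} → k < n → 0 < k → (p ∸ 1) * ν (k !) < k) → 0 < n → (p ∸ 1) * ν (n !) < n
    go n rec 0<n = subst (λ m → (p ∸ 1) * ν (m !) < m) (sym n≡pk+r)
      ([p∸1]*ν[pk+r]!<pk+r k (m%n<n n p) (subst (0 <_) n≡pk+r 0<n) (λ 0<k → rec (k<n 0<k) 0<k))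
      where
      k = n / p
      n≡pk+r : n ≡ p * k + n % p
      n≡pk+r = trans (m≡m%n+[m/n]*n n p) (trans (+-comm (n % p) (k * p)) (cong (_+ n % p) (*-comm k p)))
      k<n : 0 < k → k < n
      k<n 0<k = subst (k <_) (sym n≡pk+r)
        (<-≤-trans (subst (k <_) (*-comm k p) (m<m*n k p {{>-nonZero 0<k}} 1<p)) (m≤m+n (p * k) (n % p)))

  N*ν[j!]≤c*j : ∀ {N c} → suc ((p ∸ 1) * c) ≡ N → ∀ {j} → j ≤ N → N * ν (j !) ≤ c * j
  N*ν[j!]≤c*j {N} {c} _ {zero} _ = subst₂ _≤_ (sym (trans (cong (N *_) ν-1) (*-zeroʳ N))) (sym (*-zeroʳ c)) z≤n
  N*ν[j!]≤c*j {N} {c} [p∸1]c+1≡N {suc j} j<N = *-cancelˡ-≤ (p ∸ 1) {{p∸1≢0}} (+-cancelʳ-≤ N _ _ (begin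
    (p ∸ 1) * (N * ν (suc j !)) + N      ≡⟨ distrib (p ∸ 1) N (ν (suc j !)) ⟩
    N * suc ((p ∸ 1) * ν (suc j !))      ≤⟨ *-monoʳ-≤ N ([p∸1]*ν[n!]<n (suc j) z<s) ⟩
    N * suc j                            ≡⟨ cong (_* suc j) [p∸1]c+1≡N ⟨
    suc ((p ∸ 1) * c) * suc j            ≡⟨ expand (p ∸ 1) c (suc j) ⟩
    (p ∸ 1) * (c * suc j) + suc j        ≤⟨ +-monoʳ-≤ ((p ∸ 1) * (c * suc j)) j<N ⟩
    (p ∸ 1) * (c * suc j) + N            ∎))
    where
    open ≤-Reasoning
    p∸1≢0 : NonZero (p ∸ 1)
    p∸1≢0 = ≢-nonZero λ p∸1≡0 → <-irrefl (trans (cong suc (sym p∸1≡0)) (suc-pred p)) 1<p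
    distrib : ∀ a b c → a * (b * c) + b ≡ b * suc (a * c)
    distrib = ℕ-Solver.solve-∀
    expand : ∀ a b c → suc (a * b) * c ≡ a * (b * c) + c
    expand = ℕ-Solver.solve-∀

  ν-[p^[1+m]]! : ∀ m → ν ((p ^ suc m) !) ≡ p ^ m + ν ((p ^ m) !)
  ν-[p^[1+m]]! m = ν-[pk]! (p ^ m)

  [p∸1]*ν[p^m!]+1≡p^m : ∀ m → suc ((p ∸ 1) * ν ((p ^ m) !)) ≡ p ^ m
  [p∸1]*ν[p^m!]+1≡p^m zero    = cong suc (trans (cong ((p ∸ 1) *_) ν-1) (*-zeroʳ (p ∸ 1)))
  [p∸1]*ν[p^m!]+1≡p^m (suc m) = begin
    suc ((p ∸ 1) * ν ((p ^ suc m) !))                 ≡⟨ cong (λ x → suc ((p ∸ 1) * x)) (ν-[p^[1+m]]! m) ⟩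
    suc ((p ∸ 1) * (p ^ m + ν ((p ^ m) !)))           ≡⟨ cong suc (*-distribˡ-+ (p ∸ 1) (p ^ m) _) ⟩
    suc ((p ∸ 1) * p ^ m + (p ∸ 1) * ν ((p ^ m) !))   ≡⟨ +-suc _ _ ⟨
    (p ∸ 1) * p ^ m + suc ((p ∸ 1) * ν ((p ^ m) !))   ≡⟨ cong (λ x → (p ∸ 1) * p ^ m + x) ([p∸1]*ν[p^m!]+1≡p^m m) ⟩
    (p ∸ 1) * p ^ m + p ^ m                           ≡⟨ [p∸1]*k+k≡p*k (p ^ m) ⟩
    p ^ suc m                                         ∎
    where open ≡-Reasoning

  p∤ν[p^[1+m]!] : ∀ m → p ∤ ν ((p ^ suc m) !)
  p∤ν[p^[1+m]!] m p∣ν = p∤1 (∣m+n∣m⇒∣n (subst (p ∣_) ν≡p*c+1 p∣ν) (m∣m*n (ν ((p ^ m) !))))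
    where
    c = ν ((p ^ m) !)
    ν≡p*c+1 : ν ((p ^ suc m) !) ≡ p * c + 1
    ν≡p*c+1 = begin
      ν ((p ^ suc m) !)         ≡⟨ ν-[p^[1+m]]! m ⟩
      p ^ m + c                 ≡⟨ cong (_+ c) ([p∸1]*ν[p^m!]+1≡p^m m) ⟨
      suc ((p ∸ 1) * c) + c     ≡⟨ cong suc (+-comm ((p ∸ 1) * c) c) ⟩
      suc (c + (p ∸ 1) * c)     ≡⟨ cong (λ x → suc (x * c)) (suc-pred p) ⟩
      suc (p * c)               ≡⟨ +-comm 1 (p * c) ⟩
      p * c + 1                 ∎
      where open ≡-Reasoning

  ν-[a*p^m]! : ∀ {a} m → a < p → ν ((a * p ^ m) !) ≡ a * ν ((p ^ m) !)
  ν-[a*p^m]! {a} zero    a<p = trans (cong (λ x → ν (x !)) (*-identityʳ a))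
                                 (trans (ν-small! a<p) (sym (trans (cong (a *_) ν-1) (*-zeroʳ a))))
  ν-[a*p^m]! {a} (suc m) a<p = begin
    ν ((a * p ^ suc m) !)                ≡⟨ cong (λ x → ν (x !)) (ℕ*.x∙yz≈y∙xz a p (p ^ m)) ⟩
    ν ((p * (a * p ^ m)) !)              ≡⟨ ν-[pk]! (a * p ^ m) ⟩
    a * p ^ m + ν ((a * p ^ m) !)        ≡⟨ cong (λ x → a * p ^ m + x) (ν-[a*p^m]! m a<p) ⟩
    a * p ^ m + a * ν ((p ^ m) !)        ≡⟨ *-distribˡ-+ a (p ^ m) _ ⟨
    a * (p ^ m + ν ((p ^ m) !))          ≡⟨ cong (a *_) (ν-[p^[1+m]]! m) ⟨
    a * ν ((p ^ suc m) !)                ∎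
    where open ≡-Reasoning

-- The four polynomials

-- The exponent n ≥ 1 of the theorem appears here as suc n.
module Application (p : ℕ) (p-prime : Prime p) (p≥3 : 3 ≤ p) (n : ℕ) where
  open Valuation p p-prime
  open Factorial p p-prime

  N : ℕ
  N = p ^ suc n

  c : ℕ
  c = ν (N !)

  open Dumas p p-prime N c

  N≢0 : N ≢ 0
  N≢0 = ≢-nonZero⁻¹ N {{m^n≢0 p (suc n)}}

  ν-N : ν N ≡ suc n
  ν-N = ν-^ (suc n)

  p∣N : p ∣ N
  p∣N = m∣m*n (p ^ n)

  N∣c*d⇒N∣d : ∀ d → N ∣ c * d → N ∣ d
  N∣c*d⇒N∣d zero      _     = divides 0 refl
  N∣c*d⇒N∣d d@(suc _) N∣c*d = ≤ν⇒^∣ (subst (suc n ≤_) ν[c*d]≡ν[d] (^∣⇒≤ν c*d≢0 N∣c*d))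
    where
    p∤c : p ∤ c
    p∤c = p∤ν[p^[1+m]!] n
    c≢0 : c ≢ 0
    c≢0 c≡0 = p∤c (subst (p ∣_) (sym c≡0) (divides 0 refl))
    c*d≢0 : c * d ≢ 0
    c*d≢0 c*d≡0 = [ c≢0 , (λ ()) ]′ (m*n≡0⇒m≡0∨n≡0 c c*d≡0)
    ν[c*d]≡ν[d] : ν (c * d) ≡ ν d
    ν[c*d]≡ν[d] = trans (ν-* c≢0 (λ ())) (cong (_+ ν d) (p∤⇒ν≡0 p∤c))

  module _ (v : ℕ) (G : ℕ → ℚ)
           (G≈a : ∀ j → P-coeff N v j ≢ 0 → G j ≢ 0ℚ × νℚ (G j) ≡ + ν (P-coeff N v j))
           (ν[N+v]! : ν ((N + v) !) ≡ ν (v !) + c) where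
    private
      a = P-coeff N v
      f = applyUpTo G (suc N)

      aⱼ≢0 : ∀ {j} → j ≤ N → a j ≢ 0
      aⱼ≢0 = P-coeff≢0 {v = v}

      fⱼ≡Gⱼ : ∀ {j} → j ≤ N → coeff f j ≡ G j
      fⱼ≡Gⱼ j≤N = coeff-applyUpTo G (s≤s j≤N)

      fⱼ≢0 : ∀ {j} → j ≤ N → coeff f j ≢ 0ℚ
      fⱼ≢0 j≤N = subst (_≢ 0ℚ) (sym (fⱼ≡Gⱼ j≤N)) (proj₁ (G≈a _ (aⱼ≢0 j≤N)))

      weight-fⱼ : ∀ {j} → j ≤ N → weight (coeff f j) j ≡ + (N * ν (a j) + c * j)
      weight-fⱼ {j} j≤N = begin
        + N ℤ.* νℚ (coeff f j) ℤ.+ + (c * j)   ≡⟨ cong (λ x → + N ℤ.* νℚ x ℤ.+ + (c * j)) (fⱼ≡Gⱼ j≤N) ⟩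
        + N ℤ.* νℚ (G j) ℤ.+ + (c * j)         ≡⟨ cong (λ x → + N ℤ.* x ℤ.+ + (c * j)) (proj₂ (G≈a j (aⱼ≢0 j≤N))) ⟩
        + N ℤ.* + ν (a j) ℤ.+ + (c * j)        ≡⟨ cong (ℤ._+ + (c * j)) (ℤ.pos-* N (ν (a j))) ⟨
        + (N * ν (a j)) ℤ.+ + (c * j)          ≡⟨ ℤ.pos-+ (N * ν (a j)) (c * j) ⟨
        + (N * ν (a j) + c * j)                ∎
        where open ≡-Reasoning

      ν[a₀]≡c : ν (a 0) ≡ c
      ν[a₀]≡c = +-cancelˡ-≡ (ν (v !)) _ _ (begin
        ν (v !) + ν (a 0)   ≡⟨ +-comm (ν (v !)) (ν (a 0)) ⟩
        ν (a 0) + ν (v !)   ≡⟨ ν-* (aⱼ≢0 z≤n) (n!≢0 v) ⟨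
        ν (a 0 * v !)       ≡⟨ cong ν (P-coeff-0 N v) ⟩
        ν ((N + v) !)       ≡⟨ ν[N+v]! ⟩
        ν (v !) + c         ∎)
        where open ≡-Reasoning

      c≤ν[aⱼ]+ν[j!] : ∀ {j} → j ≤ N → c ≤ ν (a j) + ν (j !)
      c≤ν[aⱼ]+ν[j!] {j} j≤N = subst (c ≤_) (ν-* (aⱼ≢0 j≤N) (n!≢0 j))
        (ν-mono-∣ (λ aⱼj!≡0 → [ aⱼ≢0 j≤N , n!≢0 j ]′ (m*n≡0⇒m≡0∨n≡0 (a j) aⱼj!≡0)) (u!∣P-coeff*j! {v = v} j≤N))

      above-segment : ∀ j → coeff f j ≢ 0ℚ → + (N * c) ℤ.≤ weight (coeff f j) j
      above-segment j fⱼ≢0 with j ≤? N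
      ... | no  j≰N = contradiction (coeff-applyUpTo-≥ G (≰⇒> j≰N)) fⱼ≢0
      ... | yes j≤N = subst (+ (N * c) ℤ.≤_) (sym (weight-fⱼ j≤N)) (+≤+ (begin
        N * c                          ≤⟨ *-monoʳ-≤ N (c≤ν[aⱼ]+ν[j!] j≤N) ⟩
        N * (ν (a j) + ν (j !))        ≡⟨ *-distribˡ-+ N (ν (a j)) (ν (j !)) ⟩
        N * ν (a j) + N * ν (j !)      ≤⟨ +-monoʳ-≤ (N * ν (a j)) (N*ν[j!]≤c*j ([p∸1]*ν[p^m!]+1≡p^m (suc n)) j≤N) ⟩
        N * ν (a j) + c * j            ∎))
        where open ≤-Reasoning

      weight-f₀ : weight (coeff f 0) 0 ≡ + (N * c)
      weight-f₀ = trans (weight-fⱼ z≤n)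
        (cong +_ (trans (cong₂ (λ x y → N * x + y) ν[a₀]≡c (*-zeroʳ c)) (+-identityʳ (N * c))))

      weight-f_N : weight (coeff f N) N ≡ + (N * c)
      weight-f_N = trans (weight-fⱼ ≤-refl) (cong +_ (begin
        N * ν (a N) + c * N     ≡⟨ cong (λ x → N * ν x + c * N) (P-coeff-top N v) ⟩
        N * ν 1 + c * N         ≡⟨ cong (λ x → N * x + c * N) ν-1 ⟩
        N * 0 + c * N           ≡⟨ cong (_+ c * N) (*-zeroʳ N) ⟩
        c * N                   ≡⟨ *-comm c N ⟩
        N * c                   ∎))
        where open ≡-Reasoning

    P-coeff-irreducible : Irreducible (map G (upTo (suc N)))
    P-coeff-irreducible = subst Irreducible (sym (map-upTo G (suc N)))
      (dumas-irreducible (n≢0⇒n>0 N≢0) N∣c*d⇒N∣d f (λ j → coeff-applyUpTo-≥ G)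
        (fⱼ≢0 z≤n) weight-f₀ (fⱼ≢0 ≤-refl) weight-f_N above-segment)

  P-irreducible : ∀ v → ν ((N + v) !) ≡ ν (v !) + c → Irreducible (P N v)
  P-irreducible v = P-coeff-irreducible v (ℕ→ℚ ∘ P-coeff N v) (λ _ → νℚ-ℕ→ℚ)

  Q-irreducible : ∀ u → ν ((N + u) !) ≡ ν (u !) + c → Irreducible (Q u N)
  Q-irreducible u ν[N+u]! = subst Irreducible Q≡ (P-coeff-irreducible u G G≈a ν[N+u]!)
    where
    G : ℕ → ℚ
    G j = signℚ j ℚ.* ℕ→ℚ (P-coeff N u j)
    G≈a : ∀ j → P-coeff N u j ≢ 0 → G j ≢ 0ℚ × νℚ (G j) ≡ + ν (P-coeff N u j)
    G≈a j a≢0 = proj₁ (νℚ-signℚ j a≢0ℚ) , trans (proj₂ (νℚ-signℚ j a≢0ℚ)) (proj₂ (νℚ-ℕ→ℚ a≢0))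
      where a≢0ℚ = proj₁ (νℚ-ℕ→ℚ a≢0)
    Q≡ : map G (upTo (suc N)) ≡ Q u N
    Q≡ = map-cong (λ j → cong (λ x → signℚ j ℚ.* ℕ→ℚ x) (sym (Q-coeff≡P-coeff u N j))) (upTo (suc N))

  ν-[N+N]! : ν ((N + N) !) ≡ ν (N !) + c
  ν-[N+N]! = begin
    ν ((N + N) !)       ≡⟨ cong (λ x → ν ((N + x) !)) (+-identityʳ N) ⟨
    ν ((2 * N) !)       ≡⟨ ν-[a*p^m]! (suc n) p≥3 ⟩
    2 * c               ≡⟨ cong (λ x → c + x) (+-identityʳ c) ⟩
    c + c               ∎
    where open ≡-Reasoning

  ν-[N+[1+N]]! : ν ((N + suc N) !) ≡ ν (suc N !) + c
  ν-[N+[1+N]]! = begin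
    ν ((N + suc N) !)     ≡⟨ cong (λ x → ν (x !)) (+-suc N N) ⟩
    ν (suc (N + N) !)     ≡⟨ p∤⇒ν-[1+n]! (p∤1+ (∣m∣n⇒∣m+n p∣N p∣N)) ⟩
    ν ((N + N) !)         ≡⟨ ν-[N+N]! ⟩
    ν (N !) + c           ≡⟨ cong (_+ c) (p∤⇒ν-[1+n]! (p∤1+ p∣N)) ⟨
    ν (suc N !) + c       ∎
    where
    open ≡-Reasoning
    p∤1+ : ∀ {m} → p ∣ m → p ∤ suc m
    p∤1+ {m} p∣m p∣1+m = p∤1 (∣m+n∣m⇒∣n (subst (p ∣_) (+-comm 1 m) p∣1+m) p∣m)

  ν-[N+[N∸1]]! : ν ((N + (N ∸ 1)) !) ≡ ν ((N ∸ 1) !) + c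
  ν-[N+[N∸1]]! = +-cancelˡ-≡ (suc n) _ _ (begin
    suc n + ν ((N + M) !)              ≡⟨ cong (_+ ν ((N + M) !)) ν[N+N]≡1+n ⟨
    ν (N + N) + ν ((N + M) !)          ≡⟨ cong (λ x → ν x + ν ((N + M) !)) N+N≡1+[N+M] ⟩
    ν (suc (N + M)) + ν ((N + M) !)    ≡⟨ ν-[1+n]! (N + M) ⟨
    ν (suc (N + M) !)                  ≡⟨ cong (λ x → ν (x !)) N+N≡1+[N+M] ⟨
    ν ((N + N) !)                      ≡⟨ ν-[N+N]! ⟩
    ν (N !) + c                        ≡⟨ cong (λ x → ν (x !) + c) 1+M≡N ⟨
    ν (suc M !) + c                    ≡⟨ cong (_+ c) (ν-[1+n]! M) ⟩
    ν (suc M) + ν (M !) + c            ≡⟨ cong (λ x → ν x + ν (M !) + c) 1+M≡N ⟩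
    ν N + ν (M !) + c                  ≡⟨ cong (λ x → x + ν (M !) + c) ν-N ⟩
    suc n + ν (M !) + c                ≡⟨ +-assoc (suc n) (ν (M !)) c ⟩
    suc n + (ν (M !) + c)              ∎)
    where
    open ≡-Reasoning
    M = N ∸ 1
    1+M≡N : suc M ≡ N
    1+M≡N = suc-pred N {{m^n≢0 p (suc n)}}
    N+N≡1+[N+M] : N + N ≡ suc (N + M)
    N+N≡1+[N+M] = trans (cong (λ x → N + x) (sym 1+M≡N)) (+-suc N M)
    p∤2 : p ∤ 2
    p∤2 p∣2 = <⇒≱ p≥3 (∣⇒≤ p∣2)
    ν[N+N]≡1+n : ν (N + N) ≡ suc n
    ν[N+N]≡1+n = trans (cong (λ x → ν (N + x)) (sym (+-identityʳ N)))
                   (trans (ν-* (λ ()) N≢0) (cong₂ _+_ (p∤⇒ν≡0 p∤2) ν-N))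

theorem2p10 : (p n : ℕ) → Prime p → p ≥ 3 → n ≥ 1 →
    Irreducible (P (p ^ n) (suc (p ^ n))) × Irreducible (Q (p ^ n ∸ 1) (p ^ n)) × Irreducible (P (p ^ n) (p ^ n)) × Irreducible (Q (p ^ n) (p ^ n))
theorem2p10 p (suc n) p-prime p≥3 _ =
  P-irreducible (suc N) ν-[N+[1+N]]! , Q-irreducible (N ∸ 1) ν-[N+[N∸1]]! ,
  P-irreducible N ν-[N+N]! , Q-irreducible N ν-[N+N]!
  where open Application p p-prime p≥3 n
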